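{- Let $L$ be a finite set of list items and let ${A}$ be a deterministic projective list update algorithm on $L$ (with a fixed initial list state), described by its state function $S$. Let $x,y,z$ be three distinct items and $i,j,k\ge 0$ integers. If the pair of unary projections $x^i,y^j$ is agile and the pair $x^i,z^k$ is agile, then $|R(x^i)|=1$.
   Context: List update problem: a list state is a linear order of the finite item set $L$, written $[x_1\ldots x_n]$ with $x_1$ at the front. A request sequence is a finite word over $L$. A deterministic algorithm with fixed initial list is identified with the function $S$ mapping each finite request sequence $\sigma$ to the list state $S(\sigma)$ after serving $\sigma$. For items $x,y$, $\sigma_{xy}$ (resp. $\sigma_x$) is the subsequence of $\sigma$ of requests to $x$ or $y$ (resp. to $x$), and $S_{xy}(\sigma)\in\{[xy],[yx]\}$ is the relative order of $x,y$ in $S(\sigma)$. The algorithm is projective if $S_{xy}(\sigma)=S_{xy}(\sigma_{xy})$ for all $x,y,\sigma$. $x^i$ denotes the sequence of $i$ requests to $x$ (a unary projection); if $\sigma_x=x^i$, $x_{(q)}$ denotes the $q$th request to $x$ in $\sigma$ ($1\le q\le i$). $\mathrm{perm}(x^iy^j)$ is the set of all request sequences consisting of exactly $i$ requests to $x$ and $j$ requests to $y$. A pair of unary projections $x^i,y^j$ ($x\ne y$) is agile if there exist $\tau,\tau'\in\mathrm{perm}(x^iy^j)$ with $S_{xy}(\tau)=[xy]$ and $S_{xy}(\tau')=[yx]$. Requests $x_{(q)},y_{(l)}$ form an agile pair of $\sigma$ if they are adjacent in $\sigma$ and swapping them in $\sigma$ changes $S_{xy}(\sigma)$. $R(x^i)$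 is the set of requests $x_{(q)}$ ($1\le q\le i$) for which there exist an item $y$, an index $l$ and a request sequence $\sigma$ with $\sigma_x=x^i$ such that $x_{(q)},y_{(l)}$ is an agile pair of $\sigma$. -}

module Defs where

open import Data.Nat using (ℕ; suc; _+_; _≤_; _<ᵇ_)
open import Data.Fin using (Fin; toℕ; _≟_)
open import Data.Fin.Permutation using (Permutation′; _⟨$⟩ʳ_)
open import Data.List using (List; []; _∷_; _++_; filter; length; replicate)
open import Data.Bool using (Bool)
open import Data.Product using (Σ; ∃; _×_; _,_)
open import Data.Sum using (_⊎_)
open import Relation.Nullary using (¬_)
open import Relation.Nullary.Decidable using (_⊎-dec_)
open import Relation.Binary.PropositionalEquality using (_≡_; _≢_)

-- Items of L are Fin n. A list state is a linear order of the items,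
-- represented as a bijection sending each item to its position
-- (position 0 = front of the list).
ListState : ℕ → Set
ListState n = Permutation′ n

-- A deterministic algorithm with fixed initial list, identified with its
-- state function S : request sequence ↦ list state after serving it
-- (the initial list is S []).
Algorithm : ℕ → Set
Algorithm n = List (Fin n) → ListState n

module _ {n : ℕ} where

  -- S_xy(σ) = [xy]  is encoded as  relOrd (S σ) x y ≡ true
  -- (x is in front of y);  [yx]  as  false.
  relOrd : ListState n → Fin n → Fin n → Bool
  relOrd π x y = toℕ (π ⟨$⟩ʳ x) <ᵇ toℕ (π ⟨$⟩ʳ y)

  proj₁ₓ : Fin n → List (Fin n) → List (Fin n)
  proj₁ₓ x = filter (λ r → r ≟ x)

  proj₂ₓ : Fin n → Fin n → List (Fin n) → List (Fin n)
  proj₂ₓ x y = filter (λ r → (r ≟ x) ⊎-dec (r ≟ y))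

  count : Fin n → List (Fin n) → ℕ
  count x σ = length (proj₁ₓ x σ)

  Projective : Algorithm n → Set
  Projective S = ∀ (x y : Fin n) (σ : List (Fin n)) →
    relOrd (S σ) x y ≡ relOrd (S (proj₂ₓ x y σ)) x y

  InPerm : Fin n → ℕ → Fin n → ℕ → List (Fin n) → Set
  InPerm x i y j τ =
    proj₂ₓ x y τ ≡ τ × proj₁ₓ x τ ≡ replicate i x × proj₁ₓ y τ ≡ replicate j y

  AgileUnary : Algorithm n → Fin n → ℕ → Fin n → ℕ → Set
  AgileUnary S x i y j =
    x ≢ y ×
    Σ (List (Fin n)) λ τ → Σ (List (Fin n)) λ τ′ →
      InPerm x i y j τ × InPerm x i y j τ′ ×
      relOrd (S τ) x y ≡ Bool.true × relOrd (S τ′) x y ≡ Bool.false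

  -- x_(q), y_(l) (1-based occurrence indices) form an agile pair of σ:
  -- they are adjacent in σ (in either order) and swapping them changes S_xy(σ).
  AgilePairOf : Algorithm n → List (Fin n) → Fin n → ℕ → Fin n → ℕ → Set
  AgilePairOf S σ x q y l =
    Σ (List (Fin n)) λ α → Σ (List (Fin n)) λ β →
      count x α + 1 ≡ q × count y α + 1 ≡ l ×
      ((σ ≡ α ++ x ∷ y ∷ β ×
          relOrd (S σ) x y ≢ relOrd (S (α ++ y ∷ x ∷ β)) x y)
       ⊎
       (σ ≡ α ++ y ∷ x ∷ β ×
          relOrd (S σ) x y ≢ relOrd (S (α ++ x ∷ y ∷ β)) x y))

  InR : Algorithm n → Fin n → ℕ → ℕ → Set
  InR S x i q =
    1 ≤ q × q ≤ i ×
    Σ (Fin n) λ y → Σ ℕ λ l → Σ (List (Fin n)) λ σ →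
      proj₁ₓ x σ ≡ replicate i x × AgilePairOf S σ x q y l

  RSingleton : Algorithm n → Fin n → ℕ → Set
  RSingleton S x i = Σ ℕ λ q → InR S x i q × (∀ q′ → InR S x i q′ → q′ ≡ q)

-- Existence: τ and τ′ in perm(x^i y^j) end in different xy-orders, so bubble-sorting
-- both to x^i y^j must at some step transpose an adjacent x, y and change the
-- xy-order; the x involved is in R(x^i).
--
-- Uniqueness: suppose x_(q) forms an agile pair with y and x_(q′) one with z, q < q′.
-- By projectivity only the {x,y}- and {x,z}-projections matter. Interleave the two
-- projected sequences along their x's so that the agile xy-pair and the agile
-- xz-pair land in different blocks (possible because q < q′). Flipping either pair
-- then sets the xy- and the xz-order independently, while the yz-projection, hence
-- the yz-order, stays fixed; one of the four choices violates transitivity of the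
-- list order. So elements of R(x^i) witnessed by different partners coincide, and
-- R(x^i) has elements witnessed by y and by z.

module Submission where

open import Defs
open import Data.Bool using (Bool; true; false; not)
open import Data.Bool.Properties using (not-¬; ¬-not)
import Data.Bool as Bool
open import Data.Empty using (⊥; ⊥-elim)
open import Data.Fin using (Fin; toℕ; _≟_)
open import Data.Fin.Permutation using (_⟨$⟩ʳ_)
open import Data.List using (List; []; _∷_; _++_; filter; length; replicate; map)
open import Data.List.Properties
  using (++-assoc; filter-++; filter-all; filter-accept; filter-reject; filter-idem;
         length-++; length-replicate; length-map; map-++)
open import Data.List.Relation.Unary.All using (All; []; _∷_)
open import Data.List.Relation.Unary.All.Properties using (++⁻; all-filter)
open import Data.List.Relation.Binary.Permutation.Propositional using (↭-refl; ↭-swap)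
open import Data.List.Relation.Binary.Permutation.Propositional.Properties
  using (↭-length; filter-↭; ++⁺ˡ)
open import Data.Nat using (ℕ; zero; suc; _+_; _<_; _≤_; _<ᵇ_; s≤s; z≤n)
open import Data.Nat.Properties
  using (+-assoc; +-suc; +-identityʳ; +-cancelˡ-≡; +-cancelʳ-<; +-monoʳ-≤; suc-injective;
         m≤n+m; m≤n⇒∃[o]m+o≡n; <-cmp; module ≤-Reasoning)
open import Data.Product using (Σ; _×_; _,_; proj₁; proj₂)
open import Data.Sum using (_⊎_; inj₁; inj₂; map₂)
import Data.Sum as Sum
open import Function using (_∘_; _⇔_; mk⇔; Equivalence)
open import Relation.Binary.Definitions using (DecidableEquality; tri<; tri≈; tri>)
open import Relation.Binary.PropositionalEquality
open import Relation.Nullary using (yes; no; contradiction)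
open import Relation.Nullary.Decidable using (_⊎-dec_)
open import Relation.Unary using (Pred; Decidable)

<ᵇ-trans : ∀ m n o {b} → (m <ᵇ n) ≡ b → (n <ᵇ o) ≡ b → (m <ᵇ o) ≡ b
<ᵇ-trans m       n       zero    _    n<o = n<o
<ᵇ-trans zero    zero    (suc o) _    n<o = n<o
<ᵇ-trans zero    (suc n) (suc o) m<n  _   = m<n
<ᵇ-trans (suc m) zero    (suc o) refl ()
<ᵇ-trans (suc m) (suc n) (suc o) m<n  n<o = <ᵇ-trans m n o m<n n<o

filter-map : ∀ {a b p q} {A : Set a} {B : Set b} {P : Pred B p} {Q : Pred A q}
  (P? : Decidable P) (Q? : Decidable Q) (f : A → B) →
  (∀ r → P (f r) ⇔ Q r) → ∀ xs → filter P? (map f xs) ≡ map f (filter Q? xs)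
filter-map P? Q? f P∘f⇔Q []       = refl
filter-map P? Q? f P∘f⇔Q (r ∷ xs) with P? (f r) | Q? r
... | yes _   | yes _  = cong (f r ∷_) (filter-map P? Q? f P∘f⇔Q xs)
... | yes Pfr | no ¬Qr = contradiction (Equivalence.to (P∘f⇔Q r) Pfr) ¬Qr
... | no ¬Pfr | yes Qr = contradiction (Equivalence.from (P∘f⇔Q r) Qr) ¬Pfr
... | no _    | no _   = filter-map P? Q? f P∘f⇔Q xs

filter-filter-⊆ : ∀ {a p q} {A : Set a} {P : Pred A p} {Q : Pred A q}
  (P? : Decidable P) (Q? : Decidable Q) →
  (∀ {r} → P r → Q r) → ∀ xs → filter P? (filter Q? xs) ≡ filter P? xs
filter-filter-⊆ P? Q? P⇒Q []       = refl
filter-filter-⊆ P? Q? P⇒Q (r ∷ xs) with Q? r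
... | yes _ with P? r
...   | yes _ = cong (r ∷_) (filter-filter-⊆ P? Q? P⇒Q xs)
...   | no _  = filter-filter-⊆ P? Q? P⇒Q xs
filter-filter-⊆ P? Q? P⇒Q (r ∷ xs) | no ¬Qr with P? r
...   | yes Pr = contradiction (P⇒Q Pr) ¬Qr
...   | no _   = filter-filter-⊆ P? Q? P⇒Q xs

All-around⁻ : ∀ {a p} {A : Set a} {P : Pred A p} xs {y ys} →
  All P (xs ++ y ∷ ys) → All P xs × All P ys
All-around⁻ xs all with ++⁻ xs all
... | all-xs , _ ∷ all-ys = all-xs , all-ys

_⊎-trans_ : ∀ {A W : Set} {a b c : A} → a ≡ b ⊎ W → b ≡ c ⊎ W → a ≡ c ⊎ W
inj₂ w ⊎-trans _      = inj₂ w
inj₁ _ ⊎-trans inj₂ w = inj₂ w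
inj₁ p ⊎-trans inj₁ q = inj₁ (trans p q)

nonconstant-onto : (f : Bool → Bool) → f true ≢ f false → ∀ b → Σ Bool λ s → f s ≡ b
nonconstant-onto f f-nonconst b with f true Bool.≟ b
... | yes ft≡b = true , ft≡b
... | no  ft≢b = false , trans (¬-not (f-nonconst ∘ sym)) (sym (¬-not (ft≢b ∘ sym)))

data Letter : Set where
  X Y Z : Letter

_≟ᴸ_ : DecidableEquality Letter
X ≟ᴸ X = yes refl
X ≟ᴸ Y = no λ ()
X ≟ᴸ Z = no λ ()
Y ≟ᴸ X = no λ ()
Y ≟ᴸ Y = yes refl
Y ≟ᴸ Z = no λ ()
Z ≟ᴸ X = no λ ()
Z ≟ᴸ Y = no λ ()
Z ≟ᴸ Z = yes refl

OneOf : Letter → Letter → Letter → Set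
OneOf U V T = T ≡ U ⊎ T ≡ V

Over : Letter → Letter → List Letter → Set
Over U V = All (OneOf U V)

restrict : Letter → Letter → List Letter → List Letter
restrict U V = filter (λ T → (T ≟ᴸ U) ⊎-dec (T ≟ᴸ V))

occ : Letter → List Letter → ℕ
occ U w = length (filter (_≟ᴸ U) w)

restrict-++ : ∀ U V u v → restrict U V (u ++ v) ≡ restrict U V u ++ restrict U V v
restrict-++ U V = filter-++ _

restrict-Over : ∀ U V {w} → Over U V w → restrict U V w ≡ w
restrict-Over U V = filter-all (λ T → (T ≟ᴸ U) ⊎-dec (T ≟ᴸ V))

occ-++ : ∀ U u v → occ U (u ++ v) ≡ occ U u + occ U v
occ-++ U u v = trans (cong length (filter-++ (_≟ᴸ U) u v)) (length-++ (filter (_≟ᴸ U) u))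

-- Interleaving a word in X, Y with a word in X, Z along their X's

beforeX : List Letter → List Letter
beforeX []      = []
beforeX (X ∷ v) = []
beforeX (T ∷ v) = T ∷ beforeX v

afterX : List Letter → List Letter
afterX []      = []
afterX (X ∷ v) = v
afterX (_ ∷ v) = afterX v

-- The X's of u and v are identified in order; the other letters of v
-- are placed directly before the X that follows them.
merge : List Letter → List Letter → List Letter
merge []      v = v
merge (X ∷ u) v = beforeX v ++ X ∷ merge u (afterX v)
merge (T ∷ u) v = T ∷ merge u v

split-at-first-X : ∀ v {k} → occ X v ≡ suc k →
  v ≡ beforeX v ++ X ∷ afterX v × occ X (afterX v) ≡ k
split-at-first-X (X ∷ v) e = refl , suc-injective e
split-at-first-X (Y ∷ v) e with split-at-first-X v e
... | v≡ , occ≡ = cong (Y ∷_) v≡ , occ≡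
split-at-first-X (Z ∷ v) e with split-at-first-X v e
... | v≡ , occ≡ = cong (Z ∷_) v≡ , occ≡

afterX-Over : ∀ {v} → Over X Z v → Over X Z (afterX v)
afterX-Over []               = []
afterX-Over (inj₁ refl ∷ o)  = o
afterX-Over (inj₂ refl ∷ o)  = afterX-Over o

restrict-XY-beforeX : ∀ {v} → Over X Z v → restrict X Y (beforeX v) ≡ []
restrict-XY-beforeX []               = refl
restrict-XY-beforeX (inj₁ refl ∷ _)  = refl
restrict-XY-beforeX (inj₂ refl ∷ o)  = restrict-XY-beforeX o

restrict-XZ-beforeX : ∀ {v} → Over X Z v → restrict X Z (beforeX v) ≡ beforeX v
restrict-XZ-beforeX []               = refl
restrict-XZ-beforeX (inj₁ refl ∷ _)  = refl
restrict-XZ-beforeX (inj₂ refl ∷ o)  = cong (Z ∷_) (restrict-XZ-beforeX o)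

restrict-XY-X-free : ∀ {v} → Over X Z v → occ X v ≡ 0 → restrict X Y v ≡ []
restrict-XY-X-free []               _  = refl
restrict-XY-X-free (inj₁ refl ∷ _)  ()
restrict-XY-X-free (inj₂ refl ∷ o)  e  = restrict-XY-X-free o e

restrict-XY-merge : ∀ {u v} → Over X Y u → Over X Z v → occ X u ≡ occ X v →
  restrict X Y (merge u v) ≡ u
restrict-XY-merge []               ov e = restrict-XY-X-free ov (sym e)
restrict-XY-merge {X ∷ u} {v} (inj₁ refl ∷ ou) ov e
  with split-at-first-X v (sym e)
... | _ , occ-afterX = begin
  restrict X Y (beforeX v ++ X ∷ merge u (afterX v))
    ≡⟨ restrict-++ X Y (beforeX v) _ ⟩
  restrict X Y (beforeX v) ++ X ∷ restrict X Y (merge u (afterX v))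
    ≡⟨ cong₂ (λ a b → a ++ X ∷ b) (restrict-XY-beforeX ov)
             (restrict-XY-merge ou (afterX-Over ov) (sym occ-afterX)) ⟩
  X ∷ u ∎
  where open ≡-Reasoning
restrict-XY-merge (inj₂ refl ∷ ou) ov e = cong (Y ∷_) (restrict-XY-merge ou ov e)

restrict-XZ-merge : ∀ {u v} → Over X Y u → Over X Z v → occ X u ≡ occ X v →
  restrict X Z (merge u v) ≡ v
restrict-XZ-merge []               ov e = restrict-Over X Z ov
restrict-XZ-merge {X ∷ u} {v} (inj₁ refl ∷ ou) ov e
  with split-at-first-X v (sym e)
... | v≡ , occ-afterX = begin
  restrict X Z (beforeX v ++ X ∷ merge u (afterX v))
    ≡⟨ restrict-++ X Z (beforeX v) _ ⟩
  restrict X Z (beforeX v) ++ X ∷ restrict X Z (merge u (afterX v))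
    ≡⟨ cong₂ (λ a b → a ++ X ∷ b) (restrict-XZ-beforeX ov)
             (restrict-XZ-merge ou (afterX-Over ov) (sym occ-afterX)) ⟩
  beforeX v ++ X ∷ afterX v
    ≡⟨ sym v≡ ⟩
  v ∎
  where open ≡-Reasoning
restrict-XZ-merge (inj₂ refl ∷ ou) ov e = restrict-XZ-merge ou ov e

split-at-X : ∀ v m k → occ X v ≡ m + suc k →
  Σ (List Letter) λ v₁ → Σ (List Letter) λ v₂ →
    v ≡ v₁ ++ X ∷ v₂ × occ X v₁ ≡ m × occ X v₂ ≡ k
split-at-X []      zero    k ()
split-at-X []      (suc m) k ()
split-at-X (X ∷ v) zero    k e = [] , v , refl , refl , suc-injective e
split-at-X (X ∷ v) (suc m) k e with split-at-X v m k (suc-injective e)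
... | v₁ , v₂ , v≡ , occ₁ , occ₂ = X ∷ v₁ , v₂ , cong (X ∷_) v≡ , cong suc occ₁ , occ₂
split-at-X (Y ∷ v) m       k e with split-at-X v m k e
... | v₁ , v₂ , v≡ , occ₁ , occ₂ = Y ∷ v₁ , v₂ , cong (Y ∷_) v≡ , occ₁ , occ₂
split-at-X (Z ∷ v) m       k e with split-at-X v m k e
... | v₁ , v₂ , v≡ , occ₁ , occ₂ = Z ∷ v₁ , v₂ , cong (Z ∷_) v≡ , occ₁ , occ₂

record AlignedSplit (A B C D : List Letter) : Set where
  field
    C₀ C₁ B₁ B₂ : List Letter
    C-split     : C ≡ C₀ ++ X ∷ C₁
    B-split     : B ≡ B₁ ++ X ∷ B₂
    occ-A≡C₀    : occ X A ≡ occ X C₀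
    occ-B₁≡C₁   : occ X B₁ ≡ occ X C₁
    occ-B₂≡D    : occ X B₂ ≡ occ X D

+-suc-cancel-gap : ∀ a b d k → a + suc b ≡ suc (a + k) + suc d → b ≡ k + suc d
+-suc-cancel-gap a b d k e = suc-injective (+-cancelˡ-≡ a _ _ (begin
  a + suc b              ≡⟨ e ⟩
  suc (a + k) + suc d    ≡⟨ cong suc (+-assoc a k (suc d)) ⟩
  suc (a + (k + suc d))  ≡⟨ sym (+-suc a (k + suc d)) ⟩
  a + suc (k + suc d)    ∎))
  where open ≡-Reasoning

aligned-split : ∀ A B C D → occ X A < occ X C →
  occ X A + suc (occ X B) ≡ occ X C + suc (occ X D) → AlignedSplit A B C D
aligned-split A B C D a<c tot with m≤n⇒∃[o]m+o≡n a<c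
... | k , a+k≡c
  with split-at-X C (occ X A) k (sym (trans (+-suc (occ X A) k) a+k≡c))
     | split-at-X B k (occ X D)
         (+-suc-cancel-gap (occ X A) (occ X B) (occ X D) k (trans tot (cong (_+ _) (sym a+k≡c))))
... | C₀ , C₁ , C≡ , occC₀ , occC₁ | B₁ , B₂ , B≡ , occB₁ , occB₂ = record
  { C-split = C≡ ; B-split = B≡
  ; occ-A≡C₀ = sym occC₀ ; occ-B₁≡C₁ = trans occB₁ (sym occC₁) ; occ-B₂≡D = occB₂ }

pair : Bool → Letter → List Letter
pair true  U = X ∷ U ∷ []
pair false U = U ∷ X ∷ []

restrict-pair : ∀ s U → restrict X U (pair s U) ≡ pair s U
restrict-pair true  U = restrict-Over X U (inj₁ refl ∷ inj₂ refl ∷ [])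
restrict-pair false U = restrict-Over X U (inj₂ refl ∷ inj₁ refl ∷ [])

restrict-XY-pair-Z : ∀ s → restrict X Y (pair s Z) ≡ X ∷ []
restrict-XY-pair-Z true  = refl
restrict-XY-pair-Z false = refl

restrict-XZ-pair-Y : ∀ s → restrict X Z (pair s Y) ≡ X ∷ []
restrict-XZ-pair-Y true  = refl
restrict-XZ-pair-Y false = refl

restrict-YZ-pair : ∀ s U → OneOf Y Z U → restrict Y Z (pair s U) ≡ U ∷ []
restrict-YZ-pair true  U (inj₁ refl) = refl
restrict-YZ-pair true  U (inj₂ refl) = refl
restrict-YZ-pair false U (inj₁ refl) = refl
restrict-YZ-pair false U (inj₂ refl) = refl

restrict-++₅ : ∀ U V a b c d e {a′ b′ c′ d′ e′} →
  restrict U V a ≡ a′ → restrict U V b ≡ b′ → restrict U V c ≡ c′ →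
  restrict U V d ≡ d′ → restrict U V e ≡ e′ →
  restrict U V (a ++ b ++ c ++ d ++ e) ≡ a′ ++ b′ ++ c′ ++ d′ ++ e′
restrict-++₅ U V a b c d e refl refl refl refl refl =
  trans (restrict-++ U V a _) (cong (restrict U V a ++_)
  (trans (restrict-++ U V b _) (cong (restrict U V b ++_)
  (trans (restrict-++ U V c _) (cong (restrict U V c ++_) (restrict-++ U V d e))))))

record Interleaving (A B C D : List Letter) : Set where
  field
    word        : Bool → Bool → List Letter
    YZ-part     : List Letter
    restrict-XY : ∀ s t → restrict X Y (word s t) ≡ A ++ pair s Y ++ B
    restrict-XZ : ∀ s t → restrict X Z (word s t) ≡ C ++ pair t Z ++ D
    restrict-YZ : ∀ s t → restrict Y Z (word s t) ≡ YZ-part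

interleave : ∀ {A B C D} → Over X Y A → Over X Y B → Over X Z C → Over X Z D →
  occ X A < occ X C → occ X A + suc (occ X B) ≡ occ X C + suc (occ X D) →
  Interleaving A B C D
interleave {A} {B} {C} {D} oA oB oC oD a<c tot = record
  { word = w ; YZ-part = YZ-part
  ; restrict-XY = XY-part ; restrict-XZ = XZ-part ; restrict-YZ = YZ-part≡ }
  where
  open AlignedSplit (aligned-split A B C D a<c tot)

  oC₀ : Over X Z C₀
  oC₀ = proj₁ (All-around⁻ C₀ (subst (Over X Z) C-split oC))
  oC₁ : Over X Z C₁
  oC₁ = proj₂ (All-around⁻ C₀ (subst (Over X Z) C-split oC))
  oB₁ : Over X Y B₁
  oB₁ = proj₁ (All-around⁻ B₁ (subst (Over X Y) B-split oB))
  oB₂ : Over X Y B₂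
  oB₂ = proj₂ (All-around⁻ B₁ (subst (Over X Y) B-split oB))

  w : Bool → Bool → List Letter
  w s t = merge A C₀ ++ pair s Y ++ merge B₁ C₁ ++ pair t Z ++ merge B₂ D

  XY-part : ∀ s t → restrict X Y (w s t) ≡ A ++ pair s Y ++ B
  XY-part s t = trans
    (restrict-++₅ X Y (merge A C₀) (pair s Y) (merge B₁ C₁) (pair t Z) (merge B₂ D)
      (restrict-XY-merge oA oC₀ occ-A≡C₀) (restrict-pair s Y)
      (restrict-XY-merge oB₁ oC₁ occ-B₁≡C₁) (restrict-XY-pair-Z t)
      (restrict-XY-merge oB₂ oD occ-B₂≡D))
    (cong (λ B′ → A ++ pair s Y ++ B′) (sym B-split))

  XZ-part : ∀ s t → restrict X Z (w s t) ≡ C ++ pair t Z ++ D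
  XZ-part s t = trans
    (restrict-++₅ X Z (merge A C₀) (pair s Y) (merge B₁ C₁) (pair t Z) (merge B₂ D)
      (restrict-XZ-merge oA oC₀ occ-A≡C₀) (restrict-XZ-pair-Y s)
      (restrict-XZ-merge oB₁ oC₁ occ-B₁≡C₁) (restrict-pair t Z)
      (restrict-XZ-merge oB₂ oD occ-B₂≡D))
    (trans (sym (++-assoc C₀ (X ∷ C₁) _)) (cong (_++ pair t Z ++ D) (sym C-split)))

  YZ-part : List Letter
  YZ-part = restrict Y Z (merge A C₀) ++ Y ∷ restrict Y Z (merge B₁ C₁)
         ++ Z ∷ restrict Y Z (merge B₂ D)

  YZ-part≡ : ∀ s t → restrict Y Z (w s t) ≡ YZ-part
  YZ-part≡ s t =
    restrict-++₅ Y Z (merge A C₀) (pair s Y) (merge B₁ C₁) (pair t Z) (merge B₂ D)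
      refl (restrict-YZ-pair s Y (inj₁ refl)) refl (restrict-YZ-pair t Z (inj₂ refl)) refl

-- Two agile swaps against a projective order on three letters

SwapChanges : (List Letter → Bool) → Letter → List Letter → List Letter → Set
SwapChanges g U A B = g (A ++ X ∷ U ∷ B) ≢ g (A ++ U ∷ X ∷ B)

module _ (ord : List Letter → Letter → Letter → Bool)
         (ord-trans : ∀ w {b} → ord w X Y ≡ b → ord w Y Z ≡ b → ord w X Z ≡ b)
         (ord-projective : ∀ U V w → ord w U V ≡ ord (restrict U V w) U V)
         where

  XY-swap-not-before-XZ-swap : ∀ {A B C D} →
    Over X Y A → Over X Y B → Over X Z C → Over X Z D →
    SwapChanges (λ w → ord w X Y) Y A B → SwapChanges (λ w → ord w X Z) Z C D →
    occ X A < occ X C → occ X A + suc (occ X B) ≡ occ X C + suc (occ X D) → ⊥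
  XY-swap-not-before-XZ-swap {A} {B} {C} {D} oA oB oC oD XY-changes XZ-changes a<c tot =
    not-¬ refl (trans (sym XZ≡b) XZ≡not-b)
    where
    open Interleaving (interleave oA oB oC oD a<c tot)
    b : Bool
    b = ord YZ-part Y Z
    s-choice : Σ Bool λ s → ord (A ++ pair s Y ++ B) X Y ≡ b
    s-choice = nonconstant-onto (λ s → ord (A ++ pair s Y ++ B) X Y) XY-changes b
    t-choice : Σ Bool λ t → ord (C ++ pair t Z ++ D) X Z ≡ not b
    t-choice = nonconstant-onto (λ t → ord (C ++ pair t Z ++ D) X Z) XZ-changes (not b)
    s t : Bool
    s = proj₁ s-choice
    t = proj₁ t-choice

    ord-via : ∀ U V {w′} → restrict U V (word s t) ≡ w′ → ord (word s t) U V ≡ ord w′ U V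
    ord-via U V r = trans (ord-projective U V (word s t)) (cong (λ w → ord w U V) r)

    XZ≡b : ord (word s t) X Z ≡ b
    XZ≡b = ord-trans (word s t)
      (trans (ord-via X Y (restrict-XY s t)) (proj₂ s-choice))
      (ord-via Y Z (restrict-YZ s t))

    XZ≡not-b : ord (word s t) X Z ≡ not b
    XZ≡not-b = trans (ord-via X Z (restrict-XZ s t)) (proj₂ t-choice)

-- Bubble sort

AgileXYSwap : (List Letter → Bool) → ℕ → Set
AgileXYSwap g i = Σ (List Letter) λ p → Σ (List Letter) λ r →
  occ X (p ++ X ∷ Y ∷ r) ≡ i × SwapChanges g Y p r

AgileXYSwap-∷ : ∀ g {i} T → AgileXYSwap (g ∘ (T ∷_)) i → AgileXYSwap g (occ X (T ∷ []) + i)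
AgileXYSwap-∷ g T (p , r , occ≡ , changes) =
  T ∷ p , r , trans (occ-++ X (T ∷ []) (p ++ X ∷ Y ∷ r)) (cong (occ X (T ∷ []) +_) occ≡) , changes

sortXY : List Letter → List Letter
sortXY t = replicate (occ X t) X ++ replicate (occ Y t) Y

occ-X-replicate-X : ∀ m → occ X (replicate m X) ≡ m
occ-X-replicate-X zero    = refl
occ-X-replicate-X (suc m) = cong suc (occ-X-replicate-X m)

occ-X-replicate-Y : ∀ m → occ X (replicate m Y) ≡ 0
occ-X-replicate-Y zero    = refl
occ-X-replicate-Y (suc m) = occ-X-replicate-Y m

occ-sortXY : ∀ t → occ X (sortXY t) ≡ occ X t
occ-sortXY t = trans (occ-++ X (replicate (occ X t) X) _)
  (trans (cong₂ _+_ (occ-X-replicate-X (occ X t)) (occ-X-replicate-Y (occ Y t))) (+-identityʳ _))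

bubble : ∀ g m r → g (Y ∷ replicate m X ++ r) ≡ g (replicate m X ++ Y ∷ r)
                    ⊎ AgileXYSwap g (occ X (replicate m X ++ r))
bubble g zero    r = inj₁ refl
bubble g (suc m) r with g (Y ∷ X ∷ replicate m X ++ r) Bool.≟ g (X ∷ Y ∷ replicate m X ++ r)
... | no  changes = inj₂ ([] , replicate m X ++ r , refl , changes ∘ sym)
... | yes same    = inj₁ same ⊎-trans map₂ (AgileXYSwap-∷ g X) (bubble (g ∘ (X ∷_)) m r)

sort-or-swap : ∀ g {t} → Over X Y t → g t ≡ g (sortXY t) ⊎ AgileXYSwap g (occ X t)
sort-or-swap g []                       = inj₁ refl
sort-or-swap g (inj₁ refl ∷ o)          = map₂ (AgileXYSwap-∷ g X) (sort-or-swap (g ∘ (X ∷_)) o)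
sort-or-swap g {Y ∷ t} (inj₂ refl ∷ o) =
  map₂ (AgileXYSwap-∷ g Y) (sort-or-swap (g ∘ (Y ∷_)) o)
  ⊎-trans map₂ (subst (AgileXYSwap g) (occ-sortXY t)) (bubble g (occ X t) (replicate (occ Y t) Y))

agile-XY-swap-exists : ∀ g {t t′} → Over X Y t → Over X Y t′ →
  occ X t ≡ occ X t′ → occ Y t ≡ occ Y t′ → g t ≢ g t′ → AgileXYSwap g (occ X t)
agile-XY-swap-exists g {t} {t′} o o′ occX≡ occY≡ differs
  with sort-or-swap g o | sort-or-swap g o′
... | inj₂ swap | _         = swap
... | inj₁ _    | inj₂ swap = subst (AgileXYSwap g) (sym occX≡) swap
... | inj₁ p    | inj₁ p′   = ⊥-elim (differs (trans p (trans (cong g sorted≡) (sym p′))))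
  where
  sorted≡ : sortXY t ≡ sortXY t′
  sorted≡ = cong₂ (λ a b → replicate a X ++ replicate b Y) occX≡ occY≡

module _ {n : ℕ} where

  relOrd-trans : ∀ (π : ListState n) u v w {b} →
    relOrd π u v ≡ b → relOrd π v w ≡ b → relOrd π u w ≡ b
  relOrd-trans π u v w = <ᵇ-trans (toℕ (π ⟨$⟩ʳ u)) (toℕ (π ⟨$⟩ʳ v)) (toℕ (π ⟨$⟩ʳ w))

  proj₁ₓ-replicate : ∀ (x : Fin n) σ → proj₁ₓ x σ ≡ replicate (count x σ) x
  proj₁ₓ-replicate x []      = refl
  proj₁ₓ-replicate x (r ∷ σ) with r ≟ x
  ... | yes refl = cong (x ∷_) (proj₁ₓ-replicate x σ)
  ... | no  _    = proj₁ₓ-replicate x σ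

  count-replicate : ∀ {x : Fin n} σ {i} → proj₁ₓ x σ ≡ replicate i x → count x σ ≡ i
  count-replicate σ {i} σₓ≡ = trans (cong length σₓ≡) (length-replicate i)

  count-swap : ∀ (x : Fin n) α u v β → count x (α ++ u ∷ v ∷ β) ≡ count x (α ++ v ∷ u ∷ β)
  count-swap x α u v β = ↭-length (filter-↭ (_≟ x) (++⁺ˡ α (↭-swap u v ↭-refl)))

  count-proj₂ₓ : ∀ (x a : Fin n) σ → count x (proj₂ₓ x a σ) ≡ count x σ
  count-proj₂ₓ x a σ = cong length (filter-filter-⊆ (_≟ x) (λ r → (r ≟ x) ⊎-dec (r ≟ a)) inj₁ σ)

  count-around : ∀ {x u : Fin n} α β → x ≢ u →
    count x (α ++ x ∷ u ∷ β) ≡ count x α + suc (count x β)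
  count-around {x} α β x≢u = trans (cong length (filter-++ (_≟ x) α _))
    (trans (length-++ (proj₁ₓ x α))
      (cong (λ l → count x α + length l)
        (trans (filter-accept (_≟ x) refl) (cong (x ∷_) (filter-reject (_≟ x) (x≢u ∘ sym))))))

  proj₂ₓ-around : ∀ {x a u v : Fin n} α β → (u ≡ x ⊎ u ≡ a) → (v ≡ x ⊎ v ≡ a) →
    proj₂ₓ x a (α ++ u ∷ v ∷ β) ≡ proj₂ₓ x a α ++ u ∷ v ∷ proj₂ₓ x a β
  proj₂ₓ-around {x} {a} {u} α β u-kept v-kept = trans (filter-++ kept? α _)
    (cong (proj₂ₓ x a α ++_)
      (trans (filter-accept kept? u-kept) (cong (u ∷_) (filter-accept kept? v-kept))))
    where
    kept? : Decidable (λ r → r ≡ x ⊎ r ≡ a)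
    kept? r = (r ≟ x) ⊎-dec (r ≟ a)

  agile-pair-oriented : ∀ (S : Algorithm n) {σ} {x a : Fin n} {q l} → AgilePairOf S σ x q a l →
    Σ (List (Fin n)) λ α → Σ (List (Fin n)) λ β →
      count x α + 1 ≡ q × count x σ ≡ count x (α ++ x ∷ a ∷ β) ×
      relOrd (S (α ++ x ∷ a ∷ β)) x a ≢ relOrd (S (α ++ a ∷ x ∷ β)) x a
  agile-pair-oriented S (α , β , count-α , _ , inj₁ (refl , changes)) =
    α , β , count-α , refl , changes
  agile-pair-oriented S {x = x} {a} (α , β , count-α , _ , inj₂ (refl , changes)) =
    α , β , count-α , count-swap x α a x β , changes ∘ sym

  agile-partner-≢ : ∀ (S : Algorithm n) {σ} {x a : Fin n} {q l} → AgilePairOf S σ x q a l → x ≢ a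
  agile-partner-≢ S (_ , _ , _ , _ , inj₁ (refl , changes)) refl = changes refl
  agile-partner-≢ S (_ , _ , _ , _ , inj₂ (refl , changes)) refl = changes refl

  InRVia : Algorithm n → Fin n → ℕ → ℕ → Fin n → Set
  InRVia S x i q a = 1 ≤ q × q ≤ i × Σ ℕ λ l → Σ (List (Fin n)) λ σ →
    proj₁ₓ x σ ≡ replicate i x × AgilePairOf S σ x q a l

  InRVia-partner-≢ : ∀ (S : Algorithm n) {x a : Fin n} {i q} → InRVia S x i q a → x ≢ a
  InRVia-partner-≢ S (_ , _ , _ , _ , _ , pair) = agile-partner-≢ S pair

  InRVia⇒InR : ∀ (S : Algorithm n) {x a : Fin n} {i q} → InRVia S x i q a → InR S x i q
  InRVia⇒InR S {a = a} (1≤q , q≤i , rest) = 1≤q , q≤i , a , rest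

module ThreeItems {n} (S : Algorithm n) (projective : Projective S)
                {x y z : Fin n} (x≢y : x ≢ y) (x≢z : x ≢ z) (y≢z : y ≢ z) where

  ⟦_⟧ : Letter → Fin n
  ⟦ X ⟧ = x
  ⟦ Y ⟧ = y
  ⟦ Z ⟧ = z

  ⟦⟧-injective : ∀ U V → ⟦ U ⟧ ≡ ⟦ V ⟧ → U ≡ V
  ⟦⟧-injective X X _ = refl
  ⟦⟧-injective Y Y _ = refl
  ⟦⟧-injective Z Z _ = refl
  ⟦⟧-injective X Y e = contradiction e x≢y
  ⟦⟧-injective X Z e = contradiction e x≢z
  ⟦⟧-injective Y Z e = contradiction e y≢z
  ⟦⟧-injective Y X e = contradiction (sym e) x≢y
  ⟦⟧-injective Z X e = contradiction (sym e) x≢z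
  ⟦⟧-injective Z Y e = contradiction (sym e) y≢z

  ⟦⟧-≡⇔ : ∀ T U → (⟦ T ⟧ ≡ ⟦ U ⟧) ⇔ (T ≡ U)
  ⟦⟧-≡⇔ T U = mk⇔ (⟦⟧-injective T U) (cong ⟦_⟧)

  word : List Letter → List (Fin n)
  word = map ⟦_⟧

  proj₂ₓ-word : ∀ U V w → proj₂ₓ ⟦ U ⟧ ⟦ V ⟧ (word w) ≡ word (restrict U V w)
  proj₂ₓ-word U V = filter-map _ (λ T → (T ≟ᴸ U) ⊎-dec (T ≟ᴸ V)) ⟦_⟧
    (λ T → mk⇔ (Sum.map (⟦⟧-injective T U) (⟦⟧-injective T V)) (Sum.map (cong ⟦_⟧) (cong ⟦_⟧)))

  count-word : ∀ U w → count ⟦ U ⟧ (word w) ≡ occ U w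
  count-word U w = trans (cong length (filter-map _ (_≟ᴸ U) ⟦_⟧ (λ T → ⟦⟧-≡⇔ T U) w))
    (length-map ⟦_⟧ (filter (_≟ᴸ U) w))

  lift-All : ∀ {U V σ} → All (λ r → r ≡ ⟦ U ⟧ ⊎ r ≡ ⟦ V ⟧) σ →
    Σ (List Letter) λ w → Over U V w × word w ≡ σ
  lift-All [] = [] , [] , refl
  lift-All {U} (inj₁ refl ∷ a) with lift-All a
  ... | w , o , w≡ = U ∷ w , inj₁ refl ∷ o , cong (⟦ U ⟧ ∷_) w≡
  lift-All {V = V} (inj₂ refl ∷ a) with lift-All a
  ... | w , o , w≡ = V ∷ w , inj₂ refl ∷ o , cong (⟦ V ⟧ ∷_) w≡

  lift : ∀ U V {σ} → proj₂ₓ ⟦ U ⟧ ⟦ V ⟧ σ ≡ σ → Σ (List Letter) λ w → Over U V w × word w ≡ σ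
  lift U V {σ} σ-over = lift-All (subst (All _) σ-over (all-filter _ σ))

  ord : List Letter → Letter → Letter → Bool
  ord w U V = relOrd (S (word w)) ⟦ U ⟧ ⟦ V ⟧

  ord-projective : ∀ U V w → ord w U V ≡ ord (restrict U V w) U V
  ord-projective U V w = trans (projective ⟦ U ⟧ ⟦ V ⟧ (word w))
    (cong (λ σ → relOrd (S σ) ⟦ U ⟧ ⟦ V ⟧) (proj₂ₓ-word U V w))

  ord-trans : ∀ w {b} → ord w X Y ≡ b → ord w Y Z ≡ b → ord w X Z ≡ b
  ord-trans w = relOrd-trans (S (word w)) x y z

  ProjectedAgilePair : Letter → ℕ → ℕ → Set
  ProjectedAgilePair U q i = Σ (List Letter) λ A → Σ (List Letter) λ B →
    Over X U A × Over X U B × occ X A + 1 ≡ q × occ X A + suc (occ X B) ≡ i ×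
    SwapChanges (λ w → ord w X U) U A B

  ord-lift : ∀ {U A B α β} → word A ≡ proj₂ₓ x ⟦ U ⟧ α → word B ≡ proj₂ₓ x ⟦ U ⟧ β →
    ∀ {V₁ V₂} → OneOf X U V₁ → OneOf X U V₂ →
    ord (A ++ V₁ ∷ V₂ ∷ B) X U ≡ relOrd (S (α ++ ⟦ V₁ ⟧ ∷ ⟦ V₂ ⟧ ∷ β)) x ⟦ U ⟧
  ord-lift {U} {A} {B} {α} {β} A≡ B≡ {V₁} {V₂} V₁-kept V₂-kept = begin
    relOrd (S (word (A ++ V₁ ∷ V₂ ∷ B))) x u
      ≡⟨ cong (λ σ → relOrd (S σ) x u) (map-++ ⟦_⟧ A (V₁ ∷ V₂ ∷ B)) ⟩
    relOrd (S (word A ++ ⟦ V₁ ⟧ ∷ ⟦ V₂ ⟧ ∷ word B)) x u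
      ≡⟨ cong₂ (λ α′ β′ → relOrd (S (α′ ++ ⟦ V₁ ⟧ ∷ ⟦ V₂ ⟧ ∷ β′)) x u) A≡ B≡ ⟩
    relOrd (S (proj₂ₓ x u α ++ ⟦ V₁ ⟧ ∷ ⟦ V₂ ⟧ ∷ proj₂ₓ x u β)) x u
      ≡⟨ cong (λ σ → relOrd (S σ) x u) (sym (proj₂ₓ-around α β (kept V₁-kept) (kept V₂-kept))) ⟩
    relOrd (S (proj₂ₓ x u (α ++ ⟦ V₁ ⟧ ∷ ⟦ V₂ ⟧ ∷ β))) x u
      ≡⟨ sym (projective x u _) ⟩
    relOrd (S (α ++ ⟦ V₁ ⟧ ∷ ⟦ V₂ ⟧ ∷ β)) x u ∎
    where
    open ≡-Reasoning
    u = ⟦ U ⟧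
    kept : ∀ {V} → OneOf X U V → ⟦ V ⟧ ≡ x ⊎ ⟦ V ⟧ ≡ u
    kept = Sum.map (cong ⟦_⟧) (cong ⟦_⟧)

  projected-agile-pair : ∀ U {q i} → X ≢ U → InRVia S x i q ⟦ U ⟧ → ProjectedAgilePair U q i
  projected-agile-pair U {i = i} X≢U (_ , _ , _ , σ , σₓ≡ , pair)
    with agile-pair-oriented S pair
  ... | α , β , count-α , count-σ , changes
    with lift X U (filter-idem _ α) | lift X U (filter-idem _ β)
  ... | A , oA , A≡ | B , oB , B≡ =
    A , B , oA , oB , trans (cong (_+ 1) occ-A) count-α , occ-i ,
    λ e → changes (trans (sym (ord-lift A≡ B≡ (inj₁ refl) (inj₂ refl)))
                    (trans e (ord-lift A≡ B≡ (inj₂ refl) (inj₁ refl))))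
    where
    u = ⟦ U ⟧
    occ-lift : ∀ w γ → word w ≡ proj₂ₓ x u γ → occ X w ≡ count x γ
    occ-lift w γ w≡ =
      trans (sym (count-word X w)) (trans (cong (count x) w≡) (count-proj₂ₓ x u γ))
    occ-A : occ X A ≡ count x α
    occ-A = occ-lift A α A≡
    occ-i : occ X A + suc (occ X B) ≡ i
    occ-i = begin
      occ X A + suc (occ X B)       ≡⟨ cong₂ (λ a b → a + suc b) occ-A (occ-lift B β B≡) ⟩
      count x α + suc (count x β)   ≡⟨ sym (count-around α β (X≢U ∘ ⟦⟧-injective X U)) ⟩
      count x (α ++ x ∷ u ∷ β)      ≡⟨ sym count-σ ⟩
      count x σ                     ≡⟨ count-replicate σ σₓ≡ ⟩
      i                             ∎
      where open ≡-Reasoning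

  XY-pair-not-before-XZ-pair : ∀ {q q′ i} →
    ProjectedAgilePair Y q i → ProjectedAgilePair Z q′ i → q < q′ → ⊥
  XY-pair-not-before-XZ-pair (A , B , oA , oB , refl , occ-AB , XY-changes)
                             (C , D , oC , oD , refl , occ-CD , XZ-changes) q<q′ =
    XY-swap-not-before-XZ-swap ord ord-trans ord-projective oA oB oC oD XY-changes XZ-changes
      (+-cancelʳ-< 1 (occ X A) (occ X C) q<q′) (trans occ-AB (sym occ-CD))

  InRVia-from-swap : ∀ {i} → AgileXYSwap (λ w → ord w X Y) i → Σ ℕ λ q → InRVia S x i q y
  InRVia-from-swap {i} (p , r , occ≡i , changes) =
    count x (word p) + 1 , m≤n+m 1 _ , q≤i , count y (word p) + 1 , word (p ++ X ∷ Y ∷ r) ,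
    σₓ≡ , word p , word r , refl , refl ,
    inj₁ (map-++ ⟦_⟧ p _ ,
          λ e → changes (trans e (cong (λ σ → relOrd (S σ) x y) (sym (map-++ ⟦_⟧ p (Y ∷ X ∷ r))))))
    where
    q≤i : count x (word p) + 1 ≤ i
    q≤i = begin
      count x (word p) + 1        ≡⟨ cong (_+ 1) (count-word X p) ⟩
      occ X p + 1                 ≤⟨ +-monoʳ-≤ (occ X p) (s≤s z≤n) ⟩
      occ X p + suc (occ X r)     ≡⟨ sym (occ-++ X p (X ∷ Y ∷ r)) ⟩
      occ X (p ++ X ∷ Y ∷ r)      ≡⟨ occ≡i ⟩
      i                           ∎
      where open ≤-Reasoning
    σₓ≡ : proj₁ₓ x (word (p ++ X ∷ Y ∷ r)) ≡ replicate i x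
    σₓ≡ = trans (proj₁ₓ-replicate x (word (p ++ X ∷ Y ∷ r)))
      (cong (λ k → replicate k x) (trans (count-word X (p ++ X ∷ Y ∷ r)) occ≡i))

  InRVia-from-agile : ∀ {i j} → AgileUnary S x i y j → Σ ℕ λ q → InRVia S x i q y
  InRVia-from-agile (_ , _ , _ , (τ-over , τₓ , τ_y) , (τ′-over , τ′ₓ , τ′_y) , τ-true , τ′-false)
    with lift X Y τ-over | lift X Y τ′-over
  ... | t , o , t≡ | t′ , o′ , t′≡ =
    InRVia-from-swap (subst (AgileXYSwap g) (occ-lift X t t≡ τₓ)
      (agile-XY-swap-exists g o o′
        (trans (occ-lift X t t≡ τₓ) (sym (occ-lift X t′ t′≡ τ′ₓ)))
        (trans (occ-lift Y t t≡ τ_y) (sym (occ-lift Y t′ t′≡ τ′_y)))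
        λ e → not-¬ refl (trans (sym (g-lift t≡ τ-true)) (trans e (g-lift t′≡ τ′-false)))))
    where
    g : List Letter → Bool
    g w = ord w X Y
    g-lift : ∀ {w σ b} → word w ≡ σ → relOrd (S σ) x y ≡ b → g w ≡ b
    g-lift w≡ σ≡b = trans (cong (λ σ → relOrd (S σ) x y) w≡) σ≡b
    occ-lift : ∀ U w {σ k} → word w ≡ σ → proj₁ₓ ⟦ U ⟧ σ ≡ replicate k ⟦ U ⟧ → occ U w ≡ k
    occ-lift U w {σ} w≡ σ≡ =
      trans (sym (count-word U w)) (trans (cong (count ⟦ U ⟧) w≡) (count-replicate σ σ≡))

InRVia-not-before : ∀ {n} (S : Algorithm n) → Projective S → ∀ {x c d : Fin n} {i q q′} →
  InRVia S x i q c → InRVia S x i q′ d → c ≢ d → q < q′ → ⊥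
InRVia-not-before S projective r r′ c≢d =
  XY-pair-not-before-XZ-pair (projected-agile-pair Y (λ ()) r) (projected-agile-pair Z (λ ()) r′)
  where open ThreeItems S projective (InRVia-partner-≢ S r) (InRVia-partner-≢ S r′) c≢d

InRVia-unique : ∀ {n} (S : Algorithm n) → Projective S → ∀ {x c d : Fin n} {i q q′} →
  InRVia S x i q c → InRVia S x i q′ d → c ≢ d → q ≡ q′
InRVia-unique S projective {q = q} {q′} r r′ c≢d with <-cmp q q′
... | tri< q<q′ _ _ = ⊥-elim (InRVia-not-before S projective r r′ c≢d q<q′)
... | tri≈ _ q≡q′ _ = q≡q′
... | tri> _ _ q′<q = ⊥-elim (InRVia-not-before S projective r′ r (c≢d ∘ sym) q′<q)

lemma8 : (n : ℕ) (S : Algorithm n) → Projective S →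
    (x y z : Fin n) → x ≢ y → x ≢ z → y ≢ z →
    (i j k : ℕ) →
    AgileUnary S x i y j → AgileUnary S x i z k →
    RSingleton S x i
lemma8 n S projective x y z x≢y x≢z y≢z i j k agile-xy agile-xz =
  q , InRVia⇒InR S r , unique
  where
  q-via-y : Σ ℕ λ q → InRVia S x i q y
  q-via-y = ThreeItems.InRVia-from-agile S projective x≢y x≢z y≢z agile-xy
  q-via-z : Σ ℕ λ q → InRVia S x i q z
  q-via-z = ThreeItems.InRVia-from-agile S projective x≢z x≢y (y≢z ∘ sym) agile-xz
  q : ℕ
  q = proj₁ q-via-y
  r : InRVia S x i q y
  r = proj₂ q-via-y
  unique : ∀ q″ → InR S x i q″ → q″ ≡ q
  unique q″ (1≤q″ , q″≤i , c , rest″) with c ≟ y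
  ... | no c≢y = InRVia-unique S projective (1≤q″ , q″≤i , rest″) r c≢y
  ... | yes refl = trans (InRVia-unique S projective (1≤q″ , q″≤i , rest″) (proj₂ q-via-z) y≢z)
                         (sym (InRVia-unique S projective r (proj₂ q-via-z) y≢z))
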